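{- Let $\mathsf{n}$ be a cyclic tuple of linear subspaces of a finite-dimensional vector space $V$ over a field $\mathbb{K}$. Then every basis of the Minkowski matroid $\mathsf{M}(\mathsf{n})$ is a BK-tuple.
   Context: A tuple is a finite indexed family of linear subspaces of $V$ (repetitions allowed); a subtuple is a subfamily indexed by a subset of the index set. For a tuple $\mathsf{k}$, $\langle\mathsf{k}\rangle=\sum_{L\in\mathsf{k}}L$ (zero for the empty tuple), $\mathfrak{c}(\mathsf{k})$ is the number of its entries, and $\delta(\mathsf{k})=\dim\langle\mathsf{k}\rangle-\mathfrak{c}(\mathsf{k})$ is its defect. A tuple is linearly independent if every subtuple (including itself) has non-negative defect. A BK-tuple is a linearly independent tuple with defect $0$. The Minkowski matroid $\mathsf{M}(\mathsf{n})$ has ground set the entries (indices) of $\mathsf{n}$ and independent sets the linearly independent subtuples; bases are maximal independent subtuples and circuits are minimal linearly dependent subtuples. A tuple $\mathsf{n}$ is cyclic if it is a union of circuits of its own Minkowski matroid $\mathsf{M}(\mathsf{n})$. -}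

module Defs where

open import Level using (Level; _⊔_) renaming (suc to lsuc)
open import Data.Nat using (ℕ; zero; suc)
open import Data.Fin using (Fin; zero; suc)
open import Data.Fin.Subset using (Subset; _∈_; _∉_; _⊆_; _⊂_; ∣_∣)
open import Data.Product using (Σ; _×_; _,_)
open import Relation.Nullary using (¬_)
open import Algebra.Bundles using (CommutativeRing)

record Field (c ℓ : Level) : Set (lsuc (c ⊔ ℓ)) where
  field
    commutativeRing : CommutativeRing c ℓ
  open CommutativeRing commutativeRing public
  field
    1≉0     : ¬ (1# ≈ 0#)
    inverse : ∀ x → ¬ (x ≈ 0#) → Σ Carrier λ y → x * y ≈ 1#

module _ {c ℓ : Level} (F : Field c ℓ) (d : ℕ) where
  open Field F using (Carrier; _≈_; _+_; _*_; 0#)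

  V : Set c
  V = Fin d → Carrier

  _≈V_ : V → V → Set ℓ
  u ≈V v = ∀ j → u j ≈ v j

  0V : V
  0V _ = 0#

  _+V_ : V → V → V
  (u +V v) j = u j + v j

  _·V_ : Carrier → V → V
  (a ·V v) j = a * v j

  ∑ : (m : ℕ) → (Fin m → V) → V
  ∑ zero    f = 0V
  ∑ (suc m) f = f zero +V ∑ m (λ i → f (suc i))

  LinIndep : (m : ℕ) → (Fin m → V) → Set (c ⊔ ℓ)
  LinIndep m b = (a : Fin m → Carrier) →
    ∑ m (λ i → a i ·V b i) ≈V 0V → ∀ i → a i ≈ 0#

  record Subspace : Set (lsuc (c ⊔ ℓ)) where
    field
      _∋_   : V → Set (c ⊔ ℓ)
      resp  : ∀ {u v} → u ≈V v → _∋_ u → _∋_ v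
      has0  : _∋_ 0V
      +-cl  : ∀ {u v} → _∋_ u → _∋_ v → _∋_ (u +V v)
      ·-cl  : ∀ a {v} → _∋_ v → _∋_ (a ·V v)
  open Subspace public

  -- dim W ≥ r : W contains r linearly independent vectors
  -- (dim W is the maximal size of a linearly independent family in W)
  DimAtLeast : (V → Set (c ⊔ ℓ)) → ℕ → Set (c ⊔ ℓ)
  DimAtLeast W r = Σ (Fin r → V) λ b → (∀ i → W (b i)) × LinIndep r b

  module _ {n : ℕ} (L : Fin n → Subspace) where

    -- membership in ⟨ S ⟩ = sum of the entries L i with i ∈ S
    -- (the zero subspace for S empty)
    InSum : Subset n → V → Set (c ⊔ ℓ)
    InSum S x = Σ (Fin n → V) λ y →
      (∀ i → i ∈ S → L i ∋ y i) × (∀ i → i ∉ S → y i ≈V 0V) × (x ≈V ∑ n y)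

    -- δ(S) ≥ 0, i.e. dim ⟨S⟩ ≥ 𝔠(S)
    NonNegDefect : Subset n → Set (c ⊔ ℓ)
    NonNegDefect S = DimAtLeast (InSum S) ∣ S ∣

    ZeroDefect : Subset n → Set (c ⊔ ℓ)
    ZeroDefect S = DimAtLeast (InSum S) ∣ S ∣ × ¬ DimAtLeast (InSum S) (suc ∣ S ∣)

    -- the subtuple indexed by S is linearly independent
    -- (= S is an independent set of the Minkowski matroid M(L))
    LinIndepTuple : Subset n → Set (c ⊔ ℓ)
    LinIndepTuple S = ∀ T → T ⊆ S → NonNegDefect T

    BKTuple : Subset n → Set (c ⊔ ℓ)
    BKTuple S = LinIndepTuple S × ZeroDefect S

    IsBasis : Subset n → Set (c ⊔ ℓ)
    IsBasis B = LinIndepTuple B × (∀ T → B ⊂ T → ¬ LinIndepTuple T)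

    IsCircuit : Subset n → Set (c ⊔ ℓ)
    IsCircuit C = ¬ LinIndepTuple C × (∀ T → T ⊂ C → LinIndepTuple T)

    Cyclic : Set (c ⊔ ℓ)
    Cyclic = ∀ i → Σ (Subset n) λ C → IsCircuit C × i ∈ C

{-# OPTIONS --safe #-}
module Submission where

-- Write δ(S) = dim ⟨S⟩ − ∣S∣. For o ∉ B the tuple B ∪ {o} is dependent, which yields
-- T ⊆ B with δ(T) = 0 and L o ⊆ ⟨T⟩. By submodularity of S ↦ dim ⟨S⟩, unions of such
-- subsets of the independent B again have defect 0, so there is K ⊆ B with δ(K) = 0 and
-- L o ⊆ ⟨K⟩ for every o ∉ B. If δ(B) > 0, pick j ∈ B ∖ K and a circuit C ∋ j. Since its
-- proper subsets are independent, C can only be dependent if some independent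
-- T₀ ⊆ C ∖ {j} with δ(T₀) = 0 has L j ⊆ ⟨T₀⟩. Submodularity applied to T₀ and K ∪ ∁B
-- then gives dim ⟨S ∪ {j}⟩ ≤ ∣S∣ for S = K ∪ (T₀ ∩ B), although S ∪ {j} ⊆ B is
-- independent. So C is independent, a contradiction.
--
-- Equality in the field is not decidable, so pivots, excluded middle and finite choice
-- are used under double negation; this suffices since δ(B) ≤ 0 is a negative statement.

open import Defs
open import Level using (Level; _⊔_)
open import Function using (_∘_)
open import Data.Nat as ℕ using (ℕ; zero; suc; _∸_; _≤_; z≤n; s≤s)
import Data.Nat.Properties as ℕ
open import Data.Fin using (Fin; zero; suc)
open import Data.Fin.Subset using (Subset)
open import Data.Fin.Subset.Properties using (⊆-refl)
open import Data.Product using (Σ; _×_; _,_; proj₁; proj₂)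
open import Data.Sum as Sum using (_⊎_; inj₁; inj₂)
open import Data.Empty using (⊥; ⊥-elim)
open import Relation.Nullary using (¬_; yes; no; contradiction; ¬¬-map)
open import Relation.Nullary.Decidable using (decidable-stable; ¬¬-excluded-middle)
open import Relation.Binary.PropositionalEquality as ≡ using (_≡_; _≢_)

module DoubleNegation where

  open import Data.Fin.Subset using (inside; outside)
  open import Data.Vec using ([]; _∷_)

  private variable
    a b : Level
    A : Set a
    B : Set b
    n : ℕ

  infixl 1 _>>=_

  _>>=_ : ¬ ¬ A → (A → ¬ ¬ B) → ¬ ¬ B
  (¬¬a >>= f) ¬b = ¬¬a (λ x → f x ¬b)

  return : A → ¬ ¬ A
  return x ¬a = ¬a x

  ¬¬⊥⇒⊥ : ¬ ¬ ⊥ → ⊥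
  ¬¬⊥⇒⊥ ¬¬⊥ = ¬¬⊥ (λ ())

  ¬¬-∀-Fin : {P : Fin n → Set a} → (∀ i → ¬ ¬ P i) → ¬ ¬ (∀ i → P i)
  ¬¬-∀-Fin {n = zero}  h = return (λ ())
  ¬¬-∀-Fin {n = suc n} h = do
    p₀ ← h zero
    ps ← ¬¬-∀-Fin (λ i → h (suc i))
    return λ { zero → p₀ ; (suc i) → ps i }

  ¬¬-∀-Subset : {P : Subset n → Set a} → (∀ S → ¬ ¬ P S) → ¬ ¬ (∀ S → P S)
  ¬¬-∀-Subset {n = zero}  h = do
    p ← h []
    return λ { [] → p }
  ¬¬-∀-Subset {n = suc n} h = do
    pᵢ ← ¬¬-∀-Subset (λ S → h (inside ∷ S))
    pₒ ← ¬¬-∀-Subset (λ S → h (outside ∷ S))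
    return λ { (inside ∷ S) → pᵢ S ; (outside ∷ S) → pₒ S }

  ¬∀⇒¬¬∃¬ : {P : Fin n → Set a} → ¬ (∀ i → P i) → ¬ ¬ Σ (Fin n) (λ i → ¬ P i)
  ¬∀⇒¬¬∃¬ ¬∀ ¬∃ = ¬¬-∀-Fin (λ i ¬Pi → ¬∃ (i , ¬Pi)) ¬∀

  ¬∀¬¬⇒¬¬∃¬ : {c : Level} {P : A → Set b} {Q : A → Set c} →
              ¬ (∀ x → P x → ¬ ¬ Q x) → ¬ ¬ Σ A (λ x → P x × ¬ Q x)
  ¬∀¬¬⇒¬¬∃¬ ¬∀ ¬∃ = ¬∀ (λ x Px ¬Qx → ¬∃ (x , Px , ¬Qx))

  ¬¬-→ : (A → ¬ ¬ B) → ¬ ¬ (A → B)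
  ¬¬-→ f ¬[a→b] = ¬[a→b] (λ a → ⊥-elim (f a (λ b → ¬[a→b] (λ _ → b))))

open DoubleNegation

module Counting where

  open import Data.Nat using (_+_)
  open import Data.Vec using ([]; _∷_; here; there)
  open import Data.Fin.Subset
  open import Data.Fin.Subset.Properties using (x∈p∪q⁻; p─⊥≡p; ∪-identityʳ)
  open import Data.Sum using ([_,_])

  private variable
    n : ℕ

  +-≤-inclusion-exclusion : {k₁ k₂ z x y N : ℕ} →
    k₁ + z ≤ x → k₂ + z ≤ y → N + z ≡ x + y → k₁ + (k₂ + z) ≤ N
  +-≤-inclusion-exclusion {k₁} {k₂} {z} {x} {y} {N} k₁+z≤x k₂+z≤y N+z≡x+y =
    ℕ.+-cancelʳ-≤ z _ _ (begin
      k₁ + (k₂ + z) + z     ≡⟨ ℕ.+-assoc k₁ (k₂ + z) z ⟩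
      k₁ + (k₂ + z + z)     ≡⟨ ≡.cong (k₁ +_) (ℕ.+-comm (k₂ + z) z) ⟩
      k₁ + (z + (k₂ + z))   ≡⟨ ℕ.+-assoc k₁ z (k₂ + z) ⟨
      k₁ + z + (k₂ + z)     ≤⟨ ℕ.+-mono-≤ k₁+z≤x k₂+z≤y ⟩
      x + y                 ≡⟨ N+z≡x+y ⟨
      N + z                 ∎)
    where open ℕ.≤-Reasoning

  ∪-lub : {p q r : Subset n} → p ⊆ r → q ⊆ r → p ∪ q ⊆ r
  ∪-lub {p = p} {q} p⊆r q⊆r x∈p∪q = [ p⊆r , q⊆r ] (x∈p∪q⁻ p q x∈p∪q)

  ∷⊆∷⁻ : {p q : Subset n} {s t : Side} → s ∷ p ⊆ t ∷ q → p ⊆ q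
  ∷⊆∷⁻ s∷p⊆t∷q x∈p with s∷p⊆t∷q (there x∈p)
  ... | there x∈q = x∈q

  x∉p-x : (x : Fin n) (p : Subset n) → x ∉ p - x
  x∉p-x zero    (s ∷ p) ()
  x∉p-x (suc x) (s ∷ p) (there x∈p-x) = x∉p-x x p x∈p-x

  ∣p-x∣+1≡∣p∣ : {x : Fin n} {p : Subset n} → x ∈ p → suc ∣ p - x ∣ ≡ ∣ p ∣
  ∣p-x∣+1≡∣p∣ {x = zero}  {inside ∷ p}  here = ≡.cong (suc ∘ ∣_∣) (p─⊥≡p p)
  ∣p-x∣+1≡∣p∣ {x = suc x} {inside ∷ p}  (there x∈p) = ≡.cong suc (∣p-x∣+1≡∣p∣ x∈p)
  ∣p-x∣+1≡∣p∣ {x = suc x} {outside ∷ p} (there x∈p) = ∣p-x∣+1≡∣p∣ x∈p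

  ∣p∪⁅x⁆∣≡1+∣p∣ : {x : Fin n} {p : Subset n} → x ∉ p → ∣ p ∪ ⁅ x ⁆ ∣ ≡ suc ∣ p ∣
  ∣p∪⁅x⁆∣≡1+∣p∣ {x = zero}  {inside ∷ p}  x∉p = ⊥-elim (x∉p here)
  ∣p∪⁅x⁆∣≡1+∣p∣ {x = zero}  {outside ∷ p} x∉p = ≡.cong (suc ∘ ∣_∣) (∪-identityʳ p)
  ∣p∪⁅x⁆∣≡1+∣p∣ {x = suc x} {inside ∷ p}  x∉p = ≡.cong suc (∣p∪⁅x⁆∣≡1+∣p∣ (x∉p ∘ there))
  ∣p∪⁅x⁆∣≡1+∣p∣ {x = suc x} {outside ∷ p} x∉p = ∣p∪⁅x⁆∣≡1+∣p∣ (x∉p ∘ there)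

  ∣p∪q∣+∣p∩q∣≡∣p∣+∣q∣ : (p q : Subset n) → ∣ p ∪ q ∣ + ∣ p ∩ q ∣ ≡ ∣ p ∣ + ∣ q ∣
  ∣p∪q∣+∣p∩q∣≡∣p∣+∣q∣ []            []            = ≡.refl
  ∣p∪q∣+∣p∩q∣≡∣p∣+∣q∣ (inside  ∷ p) (inside  ∷ q) = ≡.cong suc (begin
    ∣ p ∪ q ∣ + suc ∣ p ∩ q ∣   ≡⟨ ℕ.+-suc _ _ ⟩
    suc (∣ p ∪ q ∣ + ∣ p ∩ q ∣) ≡⟨ ≡.cong suc (∣p∪q∣+∣p∩q∣≡∣p∣+∣q∣ p q) ⟩
    suc (∣ p ∣ + ∣ q ∣)         ≡⟨ ℕ.+-suc _ _ ⟨
    ∣ p ∣ + suc ∣ q ∣           ∎)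
    where open ≡.≡-Reasoning
  ∣p∪q∣+∣p∩q∣≡∣p∣+∣q∣ (inside  ∷ p) (outside ∷ q) = ≡.cong suc (∣p∪q∣+∣p∩q∣≡∣p∣+∣q∣ p q)
  ∣p∪q∣+∣p∩q∣≡∣p∣+∣q∣ (outside ∷ p) (inside  ∷ q) =
    ≡.trans (≡.cong suc (∣p∪q∣+∣p∩q∣≡∣p∣+∣q∣ p q)) (≡.sym (ℕ.+-suc _ _))
  ∣p∪q∣+∣p∩q∣≡∣p∣+∣q∣ (outside ∷ p) (outside ∷ q) = ∣p∪q∣+∣p∩q∣≡∣p∣+∣q∣ p q

  ∣q∪p∩r∣+∣p∩q∪∁r∣≡∣p∣+∣q∣ : (p q r : Subset n) → q ⊆ r →
                            ∣ q ∪ (p ∩ r) ∣ + ∣ p ∩ (q ∪ ∁ r) ∣ ≡ ∣ p ∣ + ∣ q ∣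
  ∣q∪p∩r∣+∣p∩q∪∁r∣≡∣p∣+∣q∣ [] [] [] _ = ≡.refl
  ∣q∪p∩r∣+∣p∩q∪∁r∣≡∣p∣+∣q∣ (inside ∷ p) (inside ∷ q) (inside ∷ r) q⊆r = ≡.cong suc (begin
    ∣ q ∪ (p ∩ r) ∣ + suc ∣ p ∩ (q ∪ ∁ r) ∣   ≡⟨ ℕ.+-suc _ _ ⟩
    suc (∣ q ∪ (p ∩ r) ∣ + ∣ p ∩ (q ∪ ∁ r) ∣) ≡⟨ ≡.cong suc (∣q∪p∩r∣+∣p∩q∪∁r∣≡∣p∣+∣q∣ p q r (∷⊆∷⁻ q⊆r)) ⟩
    suc (∣ p ∣ + ∣ q ∣)                       ≡⟨ ℕ.+-suc _ _ ⟨
    ∣ p ∣ + suc ∣ q ∣                         ∎)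
    where open ≡.≡-Reasoning
  ∣q∪p∩r∣+∣p∩q∪∁r∣≡∣p∣+∣q∣ (s ∷ p) (inside ∷ q) (outside ∷ r) q⊆r with () ← q⊆r here
  ∣q∪p∩r∣+∣p∩q∪∁r∣≡∣p∣+∣q∣ (inside ∷ p) (outside ∷ q) (inside ∷ r) q⊆r =
    ≡.cong suc (∣q∪p∩r∣+∣p∩q∪∁r∣≡∣p∣+∣q∣ p q r (∷⊆∷⁻ q⊆r))
  ∣q∪p∩r∣+∣p∩q∪∁r∣≡∣p∣+∣q∣ (inside ∷ p) (outside ∷ q) (outside ∷ r) q⊆r =
    ≡.trans (ℕ.+-suc _ _) (≡.cong suc (∣q∪p∩r∣+∣p∩q∪∁r∣≡∣p∣+∣q∣ p q r (∷⊆∷⁻ q⊆r)))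
  ∣q∪p∩r∣+∣p∩q∪∁r∣≡∣p∣+∣q∣ (outside ∷ p) (inside ∷ q) (inside ∷ r) q⊆r =
    ≡.trans (≡.cong suc (∣q∪p∩r∣+∣p∩q∪∁r∣≡∣p∣+∣q∣ p q r (∷⊆∷⁻ q⊆r))) (≡.sym (ℕ.+-suc _ _))
  ∣q∪p∩r∣+∣p∩q∪∁r∣≡∣p∣+∣q∣ (outside ∷ p) (outside ∷ q) (inside ∷ r) q⊆r =
    ∣q∪p∩r∣+∣p∩q∪∁r∣≡∣p∣+∣q∣ p q r (∷⊆∷⁻ q⊆r)
  ∣q∪p∩r∣+∣p∩q∪∁r∣≡∣p∣+∣q∣ (outside ∷ p) (outside ∷ q) (outside ∷ r) q⊆r =
    ∣q∪p∩r∣+∣p∩q∪∁r∣≡∣p∣+∣q∣ p q r (∷⊆∷⁻ q⊆r)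

open Counting

module Vectors where

  open import Data.Fin using (splitAt)
  open import Data.Vec.Functional using (_∷_; _++_)
  open import Data.Sum using ([_,_]; [_,_]′)
  open import Data.Sum.Properties using ([,]-map)

  ++-All : {a p : Level} {A : Set a} {m n : ℕ} (P : A → Set p) (xs : Fin m → A) (ys : Fin n → A) →
           (∀ i → P (xs i)) → (∀ i → P (ys i)) → ∀ i → P ((xs ++ ys) i)
  ++-All {m = m} P xs ys Pxs Pys i = [_,_] {C = λ s → P ([ xs , ys ]′ s)} Pxs Pys (splitAt m i)

  ∷-++ : {a : Level} {A : Set a} {m n : ℕ} (x : A) (xs : Fin m → A) (ys : Fin n → A) →
         ∀ i → ((x ∷ xs) ++ ys) i ≡ (x ∷ (xs ++ ys)) i
  ∷-++ x xs ys zero = ≡.refl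
  ∷-++ {m = m} x xs ys (suc i) = [,]-map (splitAt m i)

open Vectors

module LinearAlgebra {c ℓ : Level} (F : Field c ℓ) where

  open import Data.Fin using (punchIn; punchOut; _≟_; _↑ˡ_; _↑ʳ_)
  open import Data.Fin.Properties using (punchIn-punchOut)
  open import Data.Vec.Functional using (_∷_; tail; _++_)
  open import Data.Vec.Functional.Properties using (lookup-++ˡ; lookup-++ʳ)

  open Field F hiding (zero)
  open import Algebra.Properties.Ring ring using (-‿distribˡ-*; -‿distribʳ-*; -1*x≈-x)
  open import Algebra.Properties.AbelianGroup +-abelianGroup using (⁻¹-∙-comm)
  open import Algebra.Properties.Group +-group using (x∙y⁻¹≈ε⇒x≈y)
  open import Algebra.Properties.CommutativeSemigroup +-commutativeSemigroup
    using (interchange; x∙yz≈y∙xz)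
  open import Relation.Binary.Reasoning.Setoid setoid

  private variable
    d m : ℕ

  infix  4 _≋_
  infixl 6 _⊕_
  infixr 7 _⊙_
  infixl 25 _+ₛ_
  infix 30 ¬¬ₛ_

  _≋_ : V F d → V F d → Set ℓ
  _≋_ {d} = _≈V_ F d

  _⊕_ : V F d → V F d → V F d
  _⊕_ {d} = _+V_ F d

  _⊙_ : Carrier → V F d → V F d
  _⊙_ {d} = _·V_ F d

  𝟎 : V F d
  𝟎 {d} = 0V F d

  ≋-refl : {u : V F d} → u ≋ u
  ≋-refl _ = refl

  ≋-sym : {u v : V F d} → u ≋ v → v ≋ u
  ≋-sym u≋v j = sym (u≋v j)

  ≋-trans : {u v w : V F d} → u ≋ v → v ≋ w → u ≋ w
  ≋-trans u≋v v≋w j = trans (u≋v j) (v≋w j)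

  ≡⇒≋ : {u v : V F d} → u ≡ v → u ≋ v
  ≡⇒≋ ≡.refl = ≋-refl

  ⊕-cong : {u u′ v v′ : V F d} → u ≋ u′ → v ≋ v′ → u ⊕ v ≋ u′ ⊕ v′
  ⊕-cong u≋u′ v≋v′ j = +-cong (u≋u′ j) (v≋v′ j)

  ⊙-cong : {a b : Carrier} {u v : V F d} → a ≈ b → u ≋ v → a ⊙ u ≋ b ⊙ v
  ⊙-cong a≈b u≋v j = *-cong a≈b (u≋v j)

  ∑ᵥ : (Fin m → V F d) → V F d
  ∑ᵥ {m} {d} = ∑ F d m

  lc : (Fin m → Carrier) → (Fin m → V F d) → V F d
  lc a b = ∑ᵥ (λ i → a i ⊙ b i)

  ∑-cong : {f g : Fin m → V F d} → (∀ i → f i ≋ g i) → ∑ᵥ f ≋ ∑ᵥ g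
  ∑-cong {zero}  f≋g = ≋-refl
  ∑-cong {suc m} f≋g = ⊕-cong (f≋g zero) (∑-cong (f≋g ∘ suc))

  ∑-𝟎 : {f : Fin m → V F d} → (∀ i → f i ≋ 𝟎) → ∑ᵥ f ≋ 𝟎
  ∑-𝟎 {zero}  f≋𝟎 = ≋-refl
  ∑-𝟎 {suc m} f≋𝟎 j = trans (+-cong (f≋𝟎 zero j) (∑-𝟎 (f≋𝟎 ∘ suc) j)) (+-identityʳ 0#)

  ∑-⊕ : (f g : Fin m → V F d) → ∑ᵥ (λ i → f i ⊕ g i) ≋ ∑ᵥ f ⊕ ∑ᵥ g
  ∑-⊕ {zero}  f g j = sym (+-identityʳ 0#)
  ∑-⊕ {suc m} f g j =
    trans (+-congˡ (∑-⊕ (f ∘ suc) (g ∘ suc) j)) (interchange (f zero j) (g zero j) _ _)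

  ∑-⊙ : (a : Carrier) (f : Fin m → V F d) → ∑ᵥ (λ i → a ⊙ f i) ≋ a ⊙ ∑ᵥ f
  ∑-⊙ {zero}  a f j = sym (zeroʳ a)
  ∑-⊙ {suc m} a f j = trans (+-congˡ (∑-⊙ a (f ∘ suc) j)) (sym (distribˡ a _ _))

  lc-𝟎 : {a : Fin m → Carrier} (b : Fin m → V F d) → (∀ i → a i ≈ 0#) → lc a b ≋ 𝟎
  lc-𝟎 b a≈0 = ∑-𝟎 (λ i j → trans (*-congʳ (a≈0 i)) (zeroˡ _))

  record LinearMap (d e : ℕ) : Set (c ⊔ ℓ) where
    field
      apply : V F d → V F e
      cong  : {u v : V F d} → u ≋ v → apply u ≋ apply v
      ⊕-hom : (u v : V F d) → apply (u ⊕ v) ≋ apply u ⊕ apply v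
      ⊙-hom : (a : Carrier) (v : V F d) → apply (a ⊙ v) ≋ a ⊙ apply v

    𝟎-hom : apply 𝟎 ≋ 𝟎
    𝟎-hom = ≋-trans (cong {𝟎} {0# ⊙ 𝟎} (λ _ → sym (zeroˡ 0#)))
                    (≋-trans (⊙-hom 0# 𝟎) (λ _ → zeroˡ _))

    ∑-hom : (f : Fin m → V F d) → apply (∑ᵥ f) ≋ ∑ᵥ (apply ∘ f)
    ∑-hom {zero}  f = 𝟎-hom
    ∑-hom {suc m} f = ≋-trans (⊕-hom (f zero) (∑ᵥ (f ∘ suc))) (⊕-cong ≋-refl (∑-hom (f ∘ suc)))

    lc-hom : (a : Fin m → Carrier) (b : Fin m → V F d) → apply (lc a b) ≋ lc a (apply ∘ b)
    lc-hom a b = ≋-trans (∑-hom (λ i → a i ⊙ b i)) (∑-cong (λ i → ⊙-hom (a i) (b i)))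

  open LinearMap using (apply)

  lc-map : (Fin m → V F d) → LinearMap m d
  lc-map {m} b = record
    { apply = λ a → lc a b
    ; cong  = λ a≈a′ → ∑-cong (λ i → ⊙-cong (a≈a′ i) ≋-refl)
    ; ⊕-hom = λ a a′ → ≋-trans (∑-cong {m} (λ i j → distribʳ (b i j) (a i) (a′ i)))
                                (∑-⊕ (λ i → a i ⊙ b i) (λ i → a′ i ⊙ b i))
    ; ⊙-hom = λ s a → ≋-trans (∑-cong {m} (λ i j → *-assoc s (a i) (b i j)))
                               (∑-⊙ s (λ i → a i ⊙ b i))
    }

  span : (Fin m → V F d) → Subspace F d
  span b = record
    { _∋_  = λ v → Σ (Fin _ → Carrier) λ a → v ≋ lc a b
    ; resp = λ { u≋v (a , u≋ab) → a , ≋-trans (≋-sym u≋v) u≋ab }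
    ; has0 = (λ _ → 0#) , ≋-sym (lc-𝟎 b (λ _ → refl))
    ; +-cl = λ { (a , u≋) (a′ , v≋) → (λ i → a i + a′ i) ,
                 ≋-trans (⊕-cong u≋ v≋) (≋-sym (LinearMap.⊕-hom (lc-map b) a a′)) }
    ; ·-cl = λ { s (a , v≋) → (λ i → s * a i) ,
                 ≋-trans (⊙-cong refl v≋) (≋-sym (LinearMap.⊙-hom (lc-map b) s a)) }
    }

  ∑-closed : (W : Subspace F d) {f : Fin m → V F d} → (∀ i → W ∋ f i) → W ∋ ∑ᵥ f
  ∑-closed {m = zero}  W f∈W = has0 W
  ∑-closed {m = suc m} W f∈W = +-cl W (f∈W zero) (∑-closed W (f∈W ∘ suc))

  span-least : (W : Subspace F d) {b : Fin m → V F d} → (∀ i → W ∋ b i) →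
               {v : V F d} → span b ∋ v → W ∋ v
  span-least W b∈W (a , v≋ab) = resp W (≋-sym v≋ab) (∑-closed W (λ i → ·-cl W (a i) (b∈W i)))

  ∈-span : (b : Fin m → V F d) (i : Fin m) → span b ∋ b i
  ∈-span b zero = (1# ∷ λ _ → 0#) , λ j →
    sym (trans (+-cong (*-identityˡ (b zero j)) (lc-𝟎 (tail b) (λ _ → refl) j)) (+-identityʳ _))
  ∈-span b (suc i) with ∈-span (tail b) i
  ... | a , bᵢ≋ = (0# ∷ a) , λ j → trans (bᵢ≋ j) (sym (trans (+-congʳ (zeroˡ _)) (+-identityˡ _)))

  LinIndep-resp : (b b′ : Fin m → V F d) → (∀ i → b i ≋ b′ i) →
                  LinIndep F d m b → LinIndep F d m b′
  LinIndep-resp b b′ b≋b′ li a ab′≋𝟎 = li a (≋-trans (∑-cong (λ i → ⊙-cong refl (b≋b′ i))) ab′≋𝟎)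

  LinIndep-tail : (b : Fin (suc m) → V F d) → LinIndep F d (suc m) b → LinIndep F d m (tail b)
  LinIndep-tail b li a ab≋𝟎 i =
    li (0# ∷ a) (λ j → trans (+-congʳ (zeroˡ _)) (trans (+-identityˡ _) (ab≋𝟎 j))) (suc i)

  LinIndep⇒head≉𝟎 : (b : Fin (suc m) → V F d) → LinIndep F d (suc m) b → ¬ b zero ≋ 𝟎
  LinIndep⇒head≉𝟎 b li b₀≋𝟎 = 1≉0 (li (1# ∷ λ _ → 0#) e₀≋𝟎 zero)
    where
    e₀≋𝟎 : lc (1# ∷ λ _ → 0#) b ≋ 𝟎
    e₀≋𝟎 j = trans (+-cong (trans (*-identityˡ _) (b₀≋𝟎 j)) (lc-𝟎 (tail b) (λ _ → refl) j))
                   (+-identityʳ 0#)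

  LinIndep-swap : (x y : V F d) (f : Fin m → V F d) →
                  LinIndep F d (suc (suc m)) (x ∷ y ∷ f) → LinIndep F d (suc (suc m)) (y ∷ x ∷ f)
  LinIndep-swap x y f li a a[yxf]≋𝟎 = λ
    { zero          → a≈0 (suc zero)
    ; (suc zero)    → a≈0 zero
    ; (suc (suc i)) → a≈0 (suc (suc i)) }
    where
    a′ = a (suc zero) ∷ a zero ∷ tail (tail a)
    a≈0 : ∀ i → a′ i ≈ 0#
    a≈0 = li a′ (λ j → trans (x∙yz≈y∙xz _ _ _) (a[yxf]≋𝟎 j))

  record Pivot (v : V F (suc d)) : Set (c ⊔ ℓ) where
    field
      pos     : Fin (suc d)
      v⁻¹     : Carrier
      v*v⁻¹≈1 : v pos * v⁻¹ ≈ 1#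

  ¬¬-pivot : {v : V F (suc d)} → ¬ v ≋ 𝟎 → ¬ ¬ Pivot v
  ¬¬-pivot {v = v} v≉𝟎 = do
    (j , vⱼ≉0) ← ¬∀⇒¬¬∃¬ v≉𝟎
    let (vⱼ⁻¹ , vⱼ*vⱼ⁻¹≈1) = inverse (v j) vⱼ≉0
    return record { pos = j ; v⁻¹ = vⱼ⁻¹ ; v*v⁻¹≈1 = vⱼ*vⱼ⁻¹≈1 }

  -- π subtracts from x the multiple of v agreeing with x at the pivot, then forgets
  -- the pivot coordinate; so its kernel is the line through v.
  module Projection {v : V F (suc d)} (P : Pivot v) where
    open Pivot P

    coord : V F (suc d) → Carrier
    coord x = x pos * v⁻¹

    π : LinearMap (suc d) d
    π = record
      { apply = λ x k → x (punchIn pos k) + - (coord x * v (punchIn pos k))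
      ; cong  = λ x≋y k → +-cong (x≋y _) (-‿cong (*-congʳ (*-congʳ (x≋y pos))))
      ; ⊕-hom = ⊕-hom
      ; ⊙-hom = ⊙-hom
      }
      where
      ⊕-hom : ∀ x y k → let k′ = punchIn pos k in
              (x k′ + y k′) + - (coord (x ⊕ y) * v k′) ≈
              (x k′ + - (coord x * v k′)) + (y k′ + - (coord y * v k′))
      ⊕-hom x y k = let k′ = punchIn pos k in begin
        (x k′ + y k′) + - (coord (x ⊕ y) * v k′)
          ≈⟨ +-congˡ (-‿cong (*-congʳ (distribʳ v⁻¹ (x pos) (y pos)))) ⟩
        (x k′ + y k′) + - ((coord x + coord y) * v k′)
          ≈⟨ +-congˡ (-‿cong (distribʳ (v k′) (coord x) (coord y))) ⟩
        (x k′ + y k′) + - (coord x * v k′ + coord y * v k′)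
          ≈⟨ +-congˡ (sym (⁻¹-∙-comm _ _)) ⟩
        (x k′ + y k′) + (- (coord x * v k′) + - (coord y * v k′))
          ≈⟨ interchange _ _ _ _ ⟩
        (x k′ + - (coord x * v k′)) + (y k′ + - (coord y * v k′)) ∎
      ⊙-hom : ∀ a x k → let k′ = punchIn pos k in
              a * x k′ + - (coord (a ⊙ x) * v k′) ≈ a * (x k′ + - (coord x * v k′))
      ⊙-hom a x k = let k′ = punchIn pos k in begin
        a * x k′ + - (coord (a ⊙ x) * v k′)   ≈⟨ +-congˡ (-‿cong (*-congʳ (*-assoc a (x pos) v⁻¹))) ⟩
        a * x k′ + - ((a * coord x) * v k′)   ≈⟨ +-congˡ (-‿cong (*-assoc a _ _)) ⟩
        a * x k′ + - (a * (coord x * v k′))   ≈⟨ +-congˡ (-‿distribʳ-* a _) ⟩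
        a * x k′ + a * - (coord x * v k′)     ≈⟨ distribˡ a _ _ ⟨
        a * (x k′ + - (coord x * v k′))       ∎

    open LinearMap π public using (lc-hom; 𝟎-hom)

    π-kernel : (x : V F (suc d)) → apply π x ≋ 𝟎 → x ≋ coord x ⊙ v
    π-kernel x πx≋𝟎 k with k ≟ pos
    ... | yes ≡.refl = sym (begin
      (x pos * v⁻¹) * v pos ≈⟨ *-assoc _ _ _ ⟩
      x pos * (v⁻¹ * v pos) ≈⟨ *-congˡ (*-comm v⁻¹ _) ⟩
      x pos * (v pos * v⁻¹) ≈⟨ *-congˡ v*v⁻¹≈1 ⟩
      x pos * 1#            ≈⟨ *-identityʳ _ ⟩
      x pos                 ∎)
    ... | no k≢pos = x∙y⁻¹≈ε⇒x≈y _ _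
      (≡.subst (λ k → x k + - (coord x * v k) ≈ 0#) (punchIn-punchOut pos≢k)
               (πx≋𝟎 (punchOut pos≢k)))
      where
      pos≢k : pos ≢ k
      pos≢k = k≢pos ∘ ≡.sym

    π-fibre : (x y : V F (suc d)) → apply π x ≋ apply π y → Σ Carrier λ s → x ≋ y ⊕ s ⊙ v
    π-fibre x y πx≋πy = coord x-y , λ k → x≈y+z (x-y≋sv k)
      where
      x-y : V F (suc d)
      x-y = x ⊕ (- 1#) ⊙ y
      πx-y≋𝟎 : apply π x-y ≋ 𝟎
      πx-y≋𝟎 = ≋-trans (LinearMap.⊕-hom π x ((- 1#) ⊙ y))
               (≋-trans (⊕-cong πx≋πy (LinearMap.⊙-hom π (- 1#) y))
               (λ k → trans (+-congˡ (-1*x≈-x _)) (-‿inverseʳ _)))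
      x-y≋sv : x-y ≋ coord x-y ⊙ v
      x-y≋sv = π-kernel x-y πx-y≋𝟎
      x≈y+z : ∀ {x y z} → x + - 1# * y ≈ z → x ≈ y + z
      x≈y+z {x} {y} {z} eq = begin
        x               ≈⟨ +-identityʳ x ⟨
        x + 0#          ≈⟨ +-congˡ (-‿inverseˡ y) ⟨
        x + (- y + y)   ≈⟨ +-assoc _ _ _ ⟨
        (x + - y) + y   ≈⟨ +-congʳ (trans (+-congˡ (sym (-1*x≈-x y))) eq) ⟩
        z + y           ≈⟨ +-comm z y ⟩
        y + z           ∎

    π-span⁻¹ : {f : Fin m → V F (suc d)} {x : V F (suc d)} →
               span (apply π ∘ f) ∋ apply π x → span (v ∷ f) ∋ x
    π-span⁻¹ {f = f} {x} (a , πx≋) with π-fibre x (lc a f) (≋-trans πx≋ (≋-sym (lc-hom a f)))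
    ... | s , x≋ = (s ∷ a) , λ k → trans (x≋ k) (+-comm _ _)

  module _ (b : Fin (suc m) → V F (suc d)) (P : Pivot (b zero)) where
    open Projection P

    LinIndep⇒LinIndep-π : LinIndep F _ (suc m) b → LinIndep F d m (apply π ∘ tail b)
    LinIndep⇒LinIndep-π li a a[πb]≋𝟎 i = li (- coord w ∷ a) [-t]b₀+w≋𝟎 (suc i)
      where
      w : V F (suc d)
      w = lc a (tail b)
      w≋tb₀ : w ≋ coord w ⊙ b zero
      w≋tb₀ = π-kernel w (≋-trans (lc-hom a (tail b)) a[πb]≋𝟎)
      [-t]b₀+w≋𝟎 : lc (- coord w ∷ a) b ≋ 𝟎
      [-t]b₀+w≋𝟎 k = trans (+-cong (sym (-‿distribˡ-* _ _)) (w≋tb₀ k)) (-‿inverseˡ _)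

    LinIndep-π⇒LinIndep : LinIndep F d m (apply π ∘ tail b) → LinIndep F _ (suc m) b
    LinIndep-π⇒LinIndep li a ab≋𝟎 = λ { zero → a₀≈0 ; (suc i) → tail-a≈0 i }
      where
      open Pivot P
      πb₀≋𝟎 : apply π (b zero) ≋ 𝟎
      πb₀≋𝟎 k = trans (+-congˡ (-‿cong (trans (*-congʳ v*v⁻¹≈1) (*-identityˡ _)))) (-‿inverseʳ _)
      tail-a≈0 : ∀ i → a (suc i) ≈ 0#
      tail-a≈0 = li (tail a) λ k → begin
        lc (tail a) (apply π ∘ tail b) k       ≈⟨ +-identityˡ _ ⟨
        0# + lc (tail a) (apply π ∘ tail b) k  ≈⟨ +-congʳ (trans (*-congˡ (πb₀≋𝟎 k)) (zeroʳ _)) ⟨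
        lc a (apply π ∘ b) k                   ≈⟨ lc-hom a b k ⟨
        apply π (lc a b) k                     ≈⟨ LinearMap.cong π ab≋𝟎 k ⟩
        apply π 𝟎 k                            ≈⟨ 𝟎-hom k ⟩
        0#                                     ∎
      a₀b₀≈0 : a zero * b zero pos ≈ 0#
      a₀b₀≈0 = trans (sym (+-identityʳ _))
                     (trans (+-congˡ (sym (lc-𝟎 (tail b) tail-a≈0 pos))) (ab≋𝟎 pos))
      a₀≈0 : a zero ≈ 0#
      a₀≈0 = begin
        a zero                      ≈⟨ *-identityʳ _ ⟨
        a zero * 1#                 ≈⟨ *-congˡ v*v⁻¹≈1 ⟨
        a zero * (b zero pos * v⁻¹) ≈⟨ *-assoc _ _ _ ⟨
        (a zero * b zero pos) * v⁻¹ ≈⟨ *-congʳ a₀b₀≈0 ⟩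
        0# * v⁻¹                    ≈⟨ zeroˡ _ ⟩
        0#                          ∎

  LinIndep⇒≤ : (b : Fin m → V F d) → LinIndep F d m b → m ≤ d
  LinIndep⇒≤ {zero}          b li = z≤n
  LinIndep⇒≤ {suc m} {zero}  b li = contradiction (li (λ _ → 1#) (λ ()) zero) 1≉0
  LinIndep⇒≤ {suc m} {suc d} b li = s≤s (decidable-stable (m ℕ.≤? d) (do
    P ← ¬¬-pivot (LinIndep⇒head≉𝟎 b li)
    return (LinIndep⇒≤ _ (LinIndep⇒LinIndep-π b P li))))

  LinIndep-in-span⇒≤ : {n : ℕ} (w : Fin m → V F d) (s : Fin n → V F d) →
                       LinIndep F d m w → (∀ i → span s ∋ w i) → m ≤ n
  LinIndep-in-span⇒≤ w s li w∈ = LinIndep⇒≤ coeffs coeffs-indep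
    where
    coeffs : Fin _ → V F _
    coeffs i = proj₁ (w∈ i)
    coeffs-indep : LinIndep F _ _ coeffs
    coeffs-indep a a[coeffs]≋𝟎 = li a
      (≋-trans (∑-cong (λ i → ⊙-cong refl (proj₂ (w∈ i))))
      (≋-trans (≋-sym (LinearMap.lc-hom (lc-map s) a coeffs))
      (≋-trans (LinearMap.cong (lc-map s) a[coeffs]≋𝟎) (LinearMap.𝟎-hom (lc-map s)))))

  LinIndep-∷ : (b : Fin m → V F d) → LinIndep F d m b →
               {v : V F d} → ¬ span b ∋ v → ¬ ¬ LinIndep F d (suc m) (v ∷ b)
  LinIndep-∷ {d = zero}          b li v∉ = contradiction ((λ _ → 0#) , λ ()) v∉
  LinIndep-∷ {zero}  {suc d}     b li {v} v∉ = do
    P ← ¬¬-pivot (λ v≋𝟎 → v∉ ((λ ()) , v≋𝟎))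
    return (LinIndep-π⇒LinIndep (v ∷ b) P (λ _ _ ()))
  LinIndep-∷ {suc m} {suc d}     b li {v} v∉ = do
    P ← ¬¬-pivot (LinIndep⇒head≉𝟎 b li)
    let open Projection P
    πv∷πb-indep ← LinIndep-∷ (apply π ∘ tail b) (LinIndep⇒LinIndep-π b P li) (v∉ ∘ π-span⁻¹)
    let b₀∷v∷b = b zero ∷ v ∷ tail b
        b₀∷v∷b-indep = LinIndep-π⇒LinIndep b₀∷v∷b P
          (LinIndep-resp (apply π v ∷ apply π ∘ tail b) (apply π ∘ tail b₀∷v∷b)
            (λ { zero → ≋-refl ; (suc i) → ≋-refl }) πv∷πb-indep)
    return (LinIndep-resp (v ∷ b zero ∷ tail b) (v ∷ b)
              (λ { zero → ≋-refl ; (suc zero) → ≋-refl ; (suc (suc i)) → ≋-refl })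
              (LinIndep-swap (b zero) v (tail b) b₀∷v∷b-indep))

  span-++ˡ : {n : ℕ} (xs : Fin m → V F d) (ys : Fin n → V F d) {v : V F d} →
             span xs ∋ v → span (xs ++ ys) ∋ v
  span-++ˡ {n = n} xs ys = span-least (span (xs ++ ys)) λ i →
    ≡.subst (span (xs ++ ys) ∋_) (lookup-++ˡ xs ys i) (∈-span (xs ++ ys) (i ↑ˡ n))

  span-++ʳ : {n : ℕ} (xs : Fin m → V F d) (ys : Fin n → V F d) {v : V F d} →
             span ys ∋ v → span (xs ++ ys) ∋ v
  span-++ʳ {m = m} xs ys = span-least (span (xs ++ ys)) λ i →
    ≡.subst (span (xs ++ ys) ∋_) (lookup-++ʳ xs ys i) (∈-span (xs ++ ys) (m ↑ʳ i))

  DimAtLeast-mono : (W W′ : V F d → Set (c ⊔ ℓ)) {k : ℕ} →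
                    (∀ {v} → W v → W′ v) → DimAtLeast F d W k → DimAtLeast F d W′ k
  DimAtLeast-mono W W′ W⊆W′ (b , b∈W , li) = b , (λ i → W⊆W′ (b∈W i)) , li

  DimAtLeast-≤ : (W : V F d → Set (c ⊔ ℓ)) {k k′ : ℕ} →
                 k ≤ k′ → DimAtLeast F d W k′ → DimAtLeast F d W k
  DimAtLeast-≤ W k≤k′ dim with ℕ.m≤n⇒m<n∨m≡n k≤k′
  ... | inj₂ ≡.refl     = dim
  ... | inj₁ (s≤s k≤k″) = let (b , b∈W , li) = dim in
    DimAtLeast-≤ W k≤k″ (tail b , b∈W ∘ suc , LinIndep-tail b li)

  DimAtLeast⇒≤ : (W : V F d → Set (c ⊔ ℓ)) {k x : ℕ} →
                 ¬ DimAtLeast F d W (suc x) → DimAtLeast F d W k → k ≤ x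
  DimAtLeast⇒≤ W ¬dim dim = ℕ.≮⇒≥ (λ x<k → ¬dim (DimAtLeast-≤ W x<k dim))

  module _ (W : Subspace F d) {z : ℕ} (u : Fin z → V F d) where

    record SpanningExtension (x : ℕ) : Set (c ⊔ ℓ) where
      field
        {k}     : ℕ
        p       : Fin k → V F d
        k+z≤x   : k ℕ.+ z ≤ x
        spans-W : ∀ v → W ∋ v → ¬ ¬ span (p ++ u) ∋ v

    ¬¬-spanning-extension : {x : ℕ} → ¬ DimAtLeast F d (W ∋_) (suc x) →
                            (∀ i → W ∋ u i) → LinIndep F d z u → ¬ ¬ SpanningExtension x
    ¬¬-spanning-extension {x} ¬dim u∈W u-indep =
      extend (x ∸ z) {0} (λ ()) (ℕ.m+[n∸m]≡n z≤x) (λ ()) u-indep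
      where
      z≤x : z ≤ x
      z≤x = DimAtLeast⇒≤ (W ∋_) ¬dim (u , u∈W , u-indep)
      extend : ∀ r {k} (p : Fin k → V F d) → k ℕ.+ z ℕ.+ r ≡ x → (∀ i → W ∋ p i) →
               LinIndep F d (k ℕ.+ z) (p ++ u) → ¬ ¬ SpanningExtension x
      extend r {k} p k+z+r≡x p∈W indep = do
        yes spans ← ¬¬-excluded-middle {A = ∀ v → W ∋ v → ¬ ¬ span (p ++ u) ∋ v}
          where no ¬spans → do
            (v , v∈W , v∉span) ← ¬∀¬¬⇒¬¬∃¬ ¬spans
            indep′ ← LinIndep-∷ (p ++ u) indep v∉span
            enlarge r k+z+r≡x v v∈W indep′
        return record
          { p = p ; k+z≤x = ≡.subst (k ℕ.+ z ≤_) k+z+r≡x (ℕ.m≤m+n (k ℕ.+ z) r)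
          ; spans-W = spans }
        where
        enlarge : ∀ r → k ℕ.+ z ℕ.+ r ≡ x → (v : V F d) → W ∋ v →
                  LinIndep F d (suc (k ℕ.+ z)) (v ∷ (p ++ u)) → ¬ ¬ SpanningExtension x
        enlarge zero    k+z≡x v v∈W indep′ = contradiction
          (≡.subst (λ n → DimAtLeast F d (W ∋_) (suc n))
                   (≡.trans (≡.sym (ℕ.+-identityʳ _)) k+z≡x)
                   (v ∷ (p ++ u) , (λ { zero → v∈W ; (suc i) → ++-All (W ∋_) p u p∈W u∈W i }) ,
                    indep′))
          ¬dim
        enlarge (suc r) k+z+r≡x v v∈W indep′ =
          extend r (v ∷ p) (≡.trans (≡.sym (ℕ.+-suc (k ℕ.+ z) r)) k+z+r≡x)
            (λ { zero → v∈W ; (suc i) → p∈W i })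
            (LinIndep-resp (v ∷ (p ++ u)) ((v ∷ p) ++ u) (λ i → ≡⇒≋ (≡.sym (∷-++ v p u i)))
                           indep′)

  _+ₛ_ : Subspace F d → Subspace F d → Subspace F d
  W₁ +ₛ W₂ = record
    { _∋_  = λ v → Σ (V F _) λ a → Σ (V F _) λ b → W₁ ∋ a × W₂ ∋ b × v ≋ a ⊕ b
    ; resp = λ { u≋v (a , b , a∈ , b∈ , u≋a+b) → a , b , a∈ , b∈ , ≋-trans (≋-sym u≋v) u≋a+b }
    ; has0 = 𝟎 , 𝟎 , has0 W₁ , has0 W₂ , (λ _ → sym (+-identityʳ 0#))
    ; +-cl = λ { (a , b , a∈ , b∈ , u≋) (a′ , b′ , a′∈ , b′∈ , v≋) →
                 a ⊕ a′ , b ⊕ b′ , +-cl W₁ a∈ a′∈ , +-cl W₂ b∈ b′∈ ,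
                 λ j → trans (+-cong (u≋ j) (v≋ j)) (interchange _ _ _ _) }
    ; ·-cl = λ { s (a , b , a∈ , b∈ , v≋) →
                 s ⊙ a , s ⊙ b , ·-cl W₁ s a∈ , ·-cl W₂ s b∈ ,
                 λ j → trans (*-congˡ (v≋ j)) (distribˡ s _ _) }
    }

  +ₛ-inj₁ : (W₁ W₂ : Subspace F d) {v : V F d} → W₁ ∋ v → W₁ +ₛ W₂ ∋ v
  +ₛ-inj₁ W₁ W₂ v∈ = _ , 𝟎 , v∈ , has0 W₂ , λ _ → sym (+-identityʳ _)

  +ₛ-inj₂ : (W₁ W₂ : Subspace F d) {v : V F d} → W₂ ∋ v → W₁ +ₛ W₂ ∋ v
  +ₛ-inj₂ W₁ W₂ v∈ = 𝟎 , _ , has0 W₁ , v∈ , λ _ → sym (+-identityˡ _)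

  ¬¬ₛ_ : Subspace F d → Subspace F d
  ¬¬ₛ W = record
    { _∋_  = λ v → ¬ ¬ W ∋ v
    ; resp = λ u≋v → ¬¬-map (resp W u≋v)
    ; has0 = return (has0 W)
    ; +-cl = λ ¬¬u∈ ¬¬v∈ → do
        u∈ ← ¬¬u∈
        v∈ ← ¬¬v∈
        return (+-cl W u∈ v∈)
    ; ·-cl = λ s → ¬¬-map (·-cl W s)
    }

  DimAtLeast-submodular : (W₁ W₂ : Subspace F d) {x y z N : ℕ} →
    ¬ DimAtLeast F d (W₁ ∋_) (suc x) → ¬ DimAtLeast F d (W₂ ∋_) (suc y) →
    DimAtLeast F d (λ v → W₁ ∋ v × W₂ ∋ v) z → N ℕ.+ z ≡ x ℕ.+ y →
    ¬ DimAtLeast F d (W₁ +ₛ W₂ ∋_) (suc N)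
  DimAtLeast-submodular {d} W₁ W₂ {x} {y} {z} {N} ¬dim₁ ¬dim₂ (u , u∈W₁∩W₂ , u-indep) N+z≡x+y
                        (w , w∈W₁+W₂ , w-indep) = ¬¬⊥⇒⊥ do
    e₁ ← ¬¬-spanning-extension W₁ u ¬dim₁ (proj₁ ∘ u∈W₁∩W₂) u-indep
    e₂ ← ¬¬-spanning-extension W₂ u ¬dim₂ (proj₂ ∘ u∈W₁∩W₂) u-indep
    contradict e₁ e₂
    where
    contradict : SpanningExtension W₁ u x → SpanningExtension W₂ u y → ¬ ¬ ⊥
    contradict record { k = k₁ ; p = p₁ ; k+z≤x = k₁+z≤x ; spans-W = spans₁ }
               record { k = k₂ ; p = p₂ ; k+z≤x = k₂+z≤y ; spans-W = spans₂ } = do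
      w∈span ← ¬¬-∀-Fin (λ i → sum-in-span (w∈W₁+W₂ i))
      return (ℕ.≤⇒≯ (+-≤-inclusion-exclusion k₁+z≤x k₂+z≤y N+z≡x+y)
                    (LinIndep-in-span⇒≤ w s w-indep w∈span))
      where
      s : Fin (k₁ ℕ.+ (k₂ ℕ.+ z)) → V F d
      s = p₁ ++ (p₂ ++ u)
      span₁⊆ : ∀ {v} → span (p₁ ++ u) ∋ v → span s ∋ v
      span₁⊆ = span-least (span s) (++-All (span s ∋_) p₁ u
        (λ i → span-++ˡ p₁ (p₂ ++ u) (∈-span p₁ i))
        (λ i → span-++ʳ p₁ (p₂ ++ u) (span-++ʳ p₂ u (∈-span u i))))
      sum-in-span : ∀ {v} → W₁ +ₛ W₂ ∋ v → ¬ ¬ span s ∋ v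
      sum-in-span (a , b , a∈W₁ , b∈W₂ , v≋a+b) = do
        a∈span ← spans₁ a a∈W₁
        b∈span ← spans₂ b b∈W₂
        return (resp (span s) (≋-sym v≋a+b)
                     (+-cl (span s) (span₁⊆ a∈span) (span-++ʳ p₁ (p₂ ++ u) b∈span)))

module TupleSums {c ℓ : Level} (F : Field c ℓ) (d : ℕ) {n : ℕ} (L : Fin n → Subspace F d) where

  open import Data.Nat using (_+_)
  open import Data.Fin using (_≟_)
  open import Data.Fin.Subset using (_∈_; _∉_; _⊆_; ∣_∣; _∪_; _∩_; _-_) renaming (⊥ to ∅)
  open import Data.Fin.Subset.Properties using (_∈?_; ∉⊥; p∩q⊆p; p∩q⊆q; x∈p∪q⁻; p─q⊆p)
  open import Data.Vec.Functional using (_∷_; updateAt)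
  open import Data.Vec.Functional.Properties using (updateAt-updates; updateAt-minimal)

  open Field F using (refl; trans; 0#; +-cong; +-congˡ; *-congˡ; zeroʳ; +-identityˡ; +-identityʳ)
  open LinearAlgebra F

  ⟨_⟩ : Subset n → Subspace F d
  ⟨ S ⟩ = record
    { _∋_  = InSum F d L S
    ; resp = λ { u≋v (y , y∈L , y≋𝟎 , u≋∑y) → y , y∈L , y≋𝟎 , ≋-trans (≋-sym u≋v) u≋∑y }
    ; has0 = (λ _ → 𝟎) , (λ i _ → has0 (L i)) , (λ _ _ → ≋-refl) ,
             ≋-sym (∑-𝟎 {m = n} (λ _ → ≋-refl))
    ; +-cl = λ { (y , y∈L , y≋𝟎 , u≋∑y) (y′ , y′∈L , y′≋𝟎 , v≋∑y′) →
                 (λ i → y i ⊕ y′ i) , (λ i i∈S → +-cl (L i) (y∈L i i∈S) (y′∈L i i∈S)) ,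
                 (λ i i∉S j → trans (+-cong (y≋𝟎 i i∉S j) (y′≋𝟎 i i∉S j)) (+-identityʳ 0#)) ,
                 ≋-trans (⊕-cong u≋∑y v≋∑y′) (≋-sym (∑-⊕ y y′)) }
    ; ·-cl = λ { a (y , y∈L , y≋𝟎 , v≋∑y) →
                 (λ i → a ⊙ y i) , (λ i i∈S → ·-cl (L i) a (y∈L i i∈S)) ,
                 (λ i i∉S j → trans (*-congˡ (y≋𝟎 i i∉S j)) (zeroʳ a)) ,
                 ≋-trans (⊙-cong refl v≋∑y) (≋-sym (∑-⊙ a y)) }
    }

  ⟨⟩-least : (W : Subspace F d) {S : Subset n} → (∀ i → i ∈ S → ∀ {v} → L i ∋ v → W ∋ v) →
             ∀ {v} → ⟨ S ⟩ ∋ v → W ∋ v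
  ⟨⟩-least W {S} L⊆W (y , y∈L , y≋𝟎 , v≋∑y) = resp W (≋-sym v≋∑y) (∑-closed W y∈W)
    where
    y∈W : ∀ i → W ∋ y i
    y∈W i with i ∈? S
    ... | yes i∈S = L⊆W i i∈S (y∈L i i∈S)
    ... | no  i∉S = resp W (≋-sym (y≋𝟎 i i∉S)) (has0 W)

  ⟨⟩-single : {S : Subset n} {i : Fin n} {v : V F d} → i ∈ S → L i ∋ v → ⟨ S ⟩ ∋ v
  ⟨⟩-single {S} {i} {v} i∈S v∈L = y , y∈L , y≋𝟎 , ≋-sym (∑-single i)
    where
    y : Fin n → V F d
    y = updateAt (λ _ → 𝟎) i (λ _ → v)
    ∑-single : ∀ {m} (i : Fin m) → ∑ᵥ (updateAt (λ _ → 𝟎) i (λ _ → v)) ≋ v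
    ∑-single {suc m} zero j = trans (+-congˡ (∑-𝟎 {m = m} (λ _ → ≋-refl) j)) (+-identityʳ _)
    ∑-single {suc m} (suc i) j = trans (+-identityˡ _) (∑-single i j)
    y∈L : ∀ k → k ∈ S → L k ∋ y k
    y∈L k _ with k ≟ i
    ... | yes ≡.refl = ≡.subst (L k ∋_) (≡.sym (updateAt-updates i (λ _ → 𝟎))) v∈L
    ... | no  k≢i    = ≡.subst (L k ∋_) (≡.sym (updateAt-minimal k i (λ _ → 𝟎) k≢i)) (has0 (L k))
    y≋𝟎 : ∀ k → k ∉ S → y k ≋ 𝟎
    y≋𝟎 k k∉S with k ≟ i
    ... | yes ≡.refl = contradiction i∈S k∉S
    ... | no  k≢i    = ≡⇒≋ (updateAt-minimal k i (λ _ → 𝟎) k≢i)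

  ⟨⟩-mono : {S S′ : Subset n} → S ⊆ S′ → ∀ {v} → ⟨ S ⟩ ∋ v → ⟨ S′ ⟩ ∋ v
  ⟨⟩-mono S⊆S′ = ⟨⟩-least ⟨ _ ⟩ (λ i i∈S → ⟨⟩-single (S⊆S′ i∈S))

  ⟨∪⟩⊆+ₛ : (X Y : Subset n) → ∀ {v} → ⟨ X ∪ Y ⟩ ∋ v → ⟨ X ⟩ +ₛ ⟨ Y ⟩ ∋ v
  ⟨∪⟩⊆+ₛ X Y = ⟨⟩-least (⟨ X ⟩ +ₛ ⟨ Y ⟩) λ i i∈X∪Y → from-side (x∈p∪q⁻ X Y i∈X∪Y)
    where
    from-side : ∀ {i v} → i ∈ X ⊎ i ∈ Y → L i ∋ v → ⟨ X ⟩ +ₛ ⟨ Y ⟩ ∋ v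
    from-side (inj₁ i∈X) v∈L = +ₛ-inj₁ ⟨ X ⟩ ⟨ Y ⟩ (⟨⟩-single i∈X v∈L)
    from-side (inj₂ i∈Y) v∈L = +ₛ-inj₂ ⟨ X ⟩ ⟨ Y ⟩ (⟨⟩-single i∈Y v∈L)

  NonPosDefect : Subset n → Set (c ⊔ ℓ)
  NonPosDefect S = ¬ DimAtLeast F d (⟨ S ⟩ ∋_) (suc ∣ S ∣)

  L[_]⊆⟨_⟩ : Fin n → Subset n → Set (c ⊔ ℓ)
  L[ o ]⊆⟨ S ⟩ = ∀ v → L o ∋ v → ¬ ¬ ⟨ S ⟩ ∋ v

  ⟨⟩-absorb : {U R : Subset n} → (∀ i → i ∈ U → i ∈ R ⊎ L[ i ]⊆⟨ R ⟩) →
              ∀ {v} → ⟨ U ⟩ ∋ v → ¬ ¬ ⟨ R ⟩ ∋ v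
  ⟨⟩-absorb {U} {R} U⊆R = ⟨⟩-least (¬¬ₛ ⟨ R ⟩) λ i i∈U → from-side (U⊆R i i∈U)
    where
    from-side : ∀ {i v} → i ∈ R ⊎ L[ i ]⊆⟨ R ⟩ → L i ∋ v → ¬ ¬ ⟨ R ⟩ ∋ v
    from-side (inj₁ i∈R) v∈L = return (⟨⟩-single i∈R v∈L)
    from-side (inj₂ L⊆R) v∈L = L⊆R _ v∈L

  ¬DimAtLeast-absorb : {U R : Subset n} {k : ℕ} → (∀ i → i ∈ U → i ∈ R ⊎ L[ i ]⊆⟨ R ⟩) →
                       ¬ DimAtLeast F d (⟨ R ⟩ ∋_) k → ¬ DimAtLeast F d (⟨ U ⟩ ∋_) k
  ¬DimAtLeast-absorb U⊆R ¬dimR (w , w∈U , w-indep) = ¬¬⊥⇒⊥ do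
    w∈R ← ¬¬-∀-Fin (λ i → ⟨⟩-absorb U⊆R (w∈U i))
    return (¬dimR (w , w∈R , w-indep))

  ⟨⟩-submodular : (X Y : Subset n) {x y z N : ℕ} →
    ¬ DimAtLeast F d (⟨ X ⟩ ∋_) (suc x) → ¬ DimAtLeast F d (⟨ Y ⟩ ∋_) (suc y) →
    DimAtLeast F d (⟨ X ∩ Y ⟩ ∋_) z → N + z ≡ x + y → ¬ DimAtLeast F d (⟨ X ∪ Y ⟩ ∋_) (suc N)
  ⟨⟩-submodular X Y ¬dimX ¬dimY dim∩ N+z≡x+y dim∪ =
    DimAtLeast-submodular ⟨ X ⟩ ⟨ Y ⟩ ¬dimX ¬dimY
      (DimAtLeast-mono (⟨ X ∩ Y ⟩ ∋_) (λ v → ⟨ X ⟩ ∋ v × ⟨ Y ⟩ ∋ v)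
                       (λ v∈ → ⟨⟩-mono (p∩q⊆p X Y) v∈ , ⟨⟩-mono (p∩q⊆q X Y) v∈) dim∩)
      N+z≡x+y (DimAtLeast-mono (⟨ X ∪ Y ⟩ ∋_) (⟨ X ⟩ +ₛ ⟨ Y ⟩ ∋_) (⟨∪⟩⊆+ₛ X Y) dim∪)

  NonPosDefect-∅ : NonPosDefect ∅
  NonPosDefect-∅ (b , b∈⟨∅⟩ , b-indep) = LinIndep⇒head≉𝟎 b b-indep (⟨∅⟩≋𝟎 (b∈⟨∅⟩ zero))
    where
    ⟨∅⟩≋𝟎 : ∀ {v} → ⟨ ∅ ⟩ ∋ v → v ≋ 𝟎
    ⟨∅⟩≋𝟎 (y , _ , y≋𝟎 , v≋∑y) = ≋-trans v≋∑y (∑-𝟎 (λ i → y≋𝟎 i ∉⊥))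

  ¬¬-LinIndepTuple : {X : Subset n} → (∀ T → T ⊆ X → ¬ ¬ NonNegDefect F d L T) →
                     ¬ ¬ LinIndepTuple F d L X
  ¬¬-LinIndepTuple indep = ¬¬-∀-Subset (λ T → ¬¬-→ (indep T))

  NonNegDefect-grow : {T : Subset n} {o : Fin n} → o ∈ T → NonNegDefect F d L (T - o) →
                      (L[ o ]⊆⟨ T - o ⟩ → ¬ NonPosDefect (T - o)) → ¬ ¬ NonNegDefect F d L T
  NonNegDefect-grow {T} {o} o∈T (b , b∈ , b-indep) ¬tight = do
    yes L⊆ ← ¬¬-excluded-middle {A = L[ o ]⊆⟨ T - o ⟩}
      where no L⊈ → do
        (v , v∈L , v∉) ← ¬∀¬¬⇒¬¬∃¬ L⊈
        v∷b-indep ← LinIndep-∷ b b-indep (v∉ ∘ span-least ⟨ T - o ⟩ b∈)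
        return (resize (v ∷ b , (λ { zero → ⟨⟩-single o∈T v∈L ; (suc i) → ⟨⟩-mono T-o⊆T (b∈ i) }) ,
                        v∷b-indep))
    ¬¬-map (resize ∘ DimAtLeast-mono (⟨ T - o ⟩ ∋_) (⟨ T ⟩ ∋_) (⟨⟩-mono T-o⊆T)) (¬tight L⊆)
    where
    T-o⊆T : T - o ⊆ T
    T-o⊆T = p─q⊆p T _
    resize : DimAtLeast F d (⟨ T ⟩ ∋_) (suc ∣ T - o ∣) → NonNegDefect F d L T
    resize = ≡.subst (DimAtLeast F d (⟨ T ⟩ ∋_)) (∣p-x∣+1≡∣p∣ o∈T)

  L⊆⟨⟩-mono : {o : Fin n} {S S′ : Subset n} → S ⊆ S′ → L[ o ]⊆⟨ S ⟩ → L[ o ]⊆⟨ S′ ⟩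
  L⊆⟨⟩-mono S⊆S′ L⊆S v v∈L = ¬¬-map (⟨⟩-mono S⊆S′) (L⊆S v v∈L)

module Basis {c ℓ : Level} (F : Field c ℓ) (d : ℕ) {n : ℕ} (L : Fin n → Subspace F d)
             (B : Subset n) (B-basis : IsBasis F d L B) where

  open import Data.Fin.Subset using (_∈_; _∉_; _⊆_; _⊂_; ∣_∣; _∪_; _∩_; _-_; ⁅_⁆; ∁)
    renaming (⊥ to ∅)
  open import Data.Fin.Subset.Properties
    using (_∈?_; ⊥⊆; ⊆-trans; ⊆-antisym; p⊆p∪q; q⊆p∪q; p∩q⊆p; p∩q⊆q; p─q⊆p;
           x∈p∪q⁺; x∈p∪q⁻; x∈⁅x⁆; x∈⁅y⁆⇒x≡y; x∈∁p⇒x∉p)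
  open import Data.List using (List; []; _∷_; allFin)
  open import Data.List.Relation.Unary.All as All using (All; []; _∷_)
  open import Data.List.Membership.Propositional.Properties using (∈-allFin)

  open TupleSums F d L

  B-indep : LinIndepTuple F d L B
  B-indep = proj₁ B-basis

  NonPosDefect-∪ : {K T : Subset n} → K ⊆ B → T ⊆ B →
                   NonPosDefect K → NonPosDefect T → NonPosDefect (K ∪ T)
  NonPosDefect-∪ {K} {T} K⊆B T⊆B K-tight T-tight =
    ⟨⟩-submodular K T K-tight T-tight (B-indep (K ∩ T) (⊆-trans (p∩q⊆p K T) K⊆B))
                  (∣p∪q∣+∣p∩q∣≡∣p∣+∣q∣ K T)

  record Absorbing (o : Fin n) (T : Subset n) : Set (c ⊔ ℓ) where
    constructor absorbing
    field
      T⊆B     : T ⊆ B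
      L⊆T     : L[ o ]⊆⟨ T ⟩
      T-tight : NonPosDefect T

  -- B ∪ {o} is dependent, and NonNegDefect-grow says where the dependence must come from.
  ¬¬-absorbing : {o : Fin n} → o ∉ B → ¬ ¬ Σ (Subset n) (Absorbing o)
  ¬¬-absorbing {o} o∉B ¬absorbing =
    ¬¬-LinIndepTuple indep (proj₂ B-basis (B ∪ ⁅ o ⁆) B⊂B∪o)
    where
    B⊂B∪o : B ⊂ B ∪ ⁅ o ⁆
    B⊂B∪o = p⊆p∪q ⁅ o ⁆ , o , x∈p∪q⁺ (inj₂ (x∈⁅x⁆ o)) , o∉B
    ⊆B : {T : Subset n} → T ⊆ B ∪ ⁅ o ⁆ → o ∉ T → T ⊆ B
    ⊆B T⊆ o∉T x∈T with x∈p∪q⁻ B ⁅ o ⁆ (T⊆ x∈T)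
    ... | inj₁ x∈B  = x∈B
    ... | inj₂ x∈⁅o⁆ with ≡.refl ← x∈⁅y⁆⇒x≡y o x∈⁅o⁆ = contradiction x∈T o∉T
    indep : ∀ T → T ⊆ B ∪ ⁅ o ⁆ → ¬ ¬ NonNegDefect F d L T
    indep T T⊆ with o ∈? T
    ... | no  o∉T = return (B-indep T (⊆B T⊆ o∉T))
    ... | yes o∈T = NonNegDefect-grow o∈T (B-indep (T - o) T-o⊆B)
                      (λ L⊆ T-o-tight → ¬absorbing (T - o , absorbing T-o⊆B L⊆ T-o-tight))
      where
      T-o⊆B : T - o ⊆ B
      T-o⊆B = ⊆B (⊆-trans (p─q⊆p T _) T⊆) (x∉p-x o T)

  record AbsorbingAll (os : List (Fin n)) (K : Subset n) : Set (c ⊔ ℓ) where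
    constructor absorbing-all
    field
      K⊆B     : K ⊆ B
      K-tight : NonPosDefect K
      L⊆K     : All (λ o → o ∉ B → L[ o ]⊆⟨ K ⟩) os

  ¬¬-absorbing-all : (os : List (Fin n)) → ¬ ¬ Σ (Subset n) (AbsorbingAll os)
  ¬¬-absorbing-all []       = return (∅ , absorbing-all ⊥⊆ NonPosDefect-∅ [])
  ¬¬-absorbing-all (o ∷ os) = do
    (K , K-absorbing) ← ¬¬-absorbing-all os
    extend K K-absorbing
    where
    extend : ∀ K → AbsorbingAll os K → ¬ ¬ Σ (Subset n) (AbsorbingAll (o ∷ os))
    extend K (absorbing-all K⊆B K-tight L⊆K) with o ∈? B
    ... | yes o∈B = return (K , absorbing-all K⊆B K-tight ((λ o∉B → contradiction o∈B o∉B) ∷ L⊆K))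
    ... | no  o∉B = do
      (T , absorbing T⊆B L⊆T T-tight) ← ¬¬-absorbing o∉B
      return (K ∪ T , absorbing-all (∪-lub K⊆B T⊆B) (NonPosDefect-∪ K⊆B T⊆B K-tight T-tight)
                        ((λ _ → L⊆⟨⟩-mono (q⊆p∪q K T) L⊆T) ∷
                         All.map (λ L⊆K-if → L⊆⟨⟩-mono (p⊆p∪q T) ∘ L⊆K-if) L⊆K))

  module _ {K : Subset n} (K⊆B : K ⊆ B) (K-tight : NonPosDefect K)
           (L⊆K : ∀ o → o ∉ B → L[ o ]⊆⟨ K ⟩) {j : Fin n} (j∈B : j ∈ B) (j∉K : j ∉ K) where

    Y : Subset n
    Y = K ∪ ∁ B

    Y-dim : ¬ DimAtLeast F d (⟨ Y ⟩ ∋_) (suc ∣ K ∣)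
    Y-dim = ¬DimAtLeast-absorb (λ i → Sum.map₂ (L⊆K i ∘ x∈∁p⇒x∉p) ∘ x∈p∪q⁻ K (∁ B)) K-tight

    -- ⟨T₀ ∪ Y⟩ contains ⟨S ∪ {j}⟩ as L j ⊆ ⟨T₀⟩, but submodularity bounds its dimension by ∣ S ∣.
    absorbing⇒¬tight : (T₀ : Subset n) → LinIndepTuple F d L T₀ → j ∉ T₀ →
                       L[ j ]⊆⟨ T₀ ⟩ → ¬ NonPosDefect T₀
    absorbing⇒¬tight T₀ T₀-indep j∉T₀ L⊆T₀ T₀-tight =
      ¬DimAtLeast-absorb S∪j⊆R R-dim
        (≡.subst (DimAtLeast F d (⟨ S ∪ ⁅ j ⁆ ⟩ ∋_)) (∣p∪⁅x⁆∣≡1+∣p∣ j∉S) (B-indep _ S∪j⊆B))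
      where
      S R : Subset n
      S = K ∪ (T₀ ∩ B)
      R = T₀ ∪ Y
      R-dim : ¬ DimAtLeast F d (⟨ R ⟩ ∋_) (suc ∣ S ∣)
      R-dim = ⟨⟩-submodular T₀ Y T₀-tight Y-dim (T₀-indep (T₀ ∩ Y) (p∩q⊆p T₀ Y))
                            (∣q∪p∩r∣+∣p∩q∪∁r∣≡∣p∣+∣q∣ T₀ K B K⊆B)
      j∉S : j ∉ S
      j∉S j∈S = Sum.[ j∉K , j∉T₀ ∘ p∩q⊆p T₀ B ] (x∈p∪q⁻ K (T₀ ∩ B) j∈S)
      S∪j⊆B : S ∪ ⁅ j ⁆ ⊆ B
      S∪j⊆B = ∪-lub (∪-lub K⊆B (p∩q⊆q T₀ B))
                    (λ x∈⁅j⁆ → ≡.subst (_∈ B) (≡.sym (x∈⁅y⁆⇒x≡y j x∈⁅j⁆)) j∈B)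
      S∪j⊆R : ∀ i → i ∈ S ∪ ⁅ j ⁆ → i ∈ R ⊎ L[ i ]⊆⟨ R ⟩
      S∪j⊆R i i∈S∪j with x∈p∪q⁻ S ⁅ j ⁆ i∈S∪j
      ... | inj₂ i∈⁅j⁆ with ≡.refl ← x∈⁅y⁆⇒x≡y j i∈⁅j⁆ = inj₂ (L⊆⟨⟩-mono (p⊆p∪q Y) L⊆T₀)
      ... | inj₁ i∈S with x∈p∪q⁻ K (T₀ ∩ B) i∈S
      ...   | inj₁ i∈K   = inj₁ (q⊆p∪q T₀ Y (p⊆p∪q (∁ B) i∈K))
      ...   | inj₂ i∈T₀B = inj₁ (p⊆p∪q Y (p∩q⊆p T₀ B i∈T₀B))

    circuit-indep : {C : Subset n} → IsCircuit F d L C → j ∈ C → ¬ ¬ LinIndepTuple F d L C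
    circuit-indep {C} (_ , C-minimal) j∈C = ¬¬-LinIndepTuple indep
      where
      indep : ∀ T → T ⊆ C → ¬ ¬ NonNegDefect F d L T
      indep T T⊆C with j ∈? T
      ... | no  j∉T = return (C-minimal T (T⊆C , j , j∈C , j∉T) T ⊆-refl)
      ... | yes j∈T = NonNegDefect-grow j∈T (T-j-indep (T - j) ⊆-refl)
                        (absorbing⇒¬tight (T - j) T-j-indep (x∉p-x j T))
        where
        T-j-indep : LinIndepTuple F d L (T - j)
        T-j-indep = C-minimal (T - j) (⊆-trans (p─q⊆p T _) T⊆C , j , j∈C , x∉p-x j T)

  NonPosDefect-B : Cyclic F d L → NonPosDefect B
  NonPosDefect-B cyclic dimB = ¬¬⊥⇒⊥ do
    (K , absorbing-all K⊆B K-tight L⊆K) ← ¬¬-absorbing-all (allFin n)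
    (j , j∈B , j∉K) ← ¬¬-B∖K K⊆B K-tight
    let (C , C-circuit , j∈C) = cyclic j
    return (circuit-indep K⊆B K-tight (λ o → All.lookup L⊆K (∈-allFin o)) j∈B j∉K
                          C-circuit j∈C (proj₁ C-circuit))
    where
    ¬¬-B∖K : ∀ {K} → K ⊆ B → NonPosDefect K → ¬ ¬ Σ (Fin n) λ j → j ∈ B × j ∉ K
    ¬¬-B∖K {K} K⊆B K-tight ¬B∖K = ≡.subst NonPosDefect (⊆-antisym K⊆B B⊆K) K-tight dimB
      where
      B⊆K : B ⊆ K
      B⊆K {j} j∈B = decidable-stable (j ∈? K) (λ j∉K → ¬B∖K (j , j∈B , j∉K))

theorem2p4 : {c ℓ : Level} (F : Field c ℓ) (d n : ℕ) (L : Fin n → Subspace F d) →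
    Cyclic F d L → (B : Subset n) → IsBasis F d L B → BKTuple F d L B
theorem2p4 F d n L cyclic B B-basis = B-indep , B-indep B ⊆-refl , NonPosDefect-B cyclic
  where open Basis F d L B B-basis
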